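{- Let $X$ be a word set on an alphabet $\mathcal{A}$, $N$ a positive integer, $u,v\in\mathcal{L}_N(X)$ and $0\le k<N$. Then $[u]\sim^{X^{[N]}}_{k}[v]$ (the relation of index $k$ and order $N$ associated with the word set $X^{[N]}$) if and only if there exists a letter $a\in\mathcal{A}$ such that $(k,u)$ and $(k,v)$ are vertices of $G_X(a,N)$ lying in the same connected component.
   Context: Words over a finite alphabet may be finite (indexed from $0$), infinite or bi-infinite; a word set is any set of such words, all assumed of length at least $N$. For a word $w$, $w_{[i,j]}=w_i\dots w_j$. $\mathcal{L}_n(Z)$ is the set of subwords of length $n$ of words of $Z$. The $N$-block presentation $X^{[N]}$ replaces each word $u$ of $X$ by the word whose $i$-th letter is the block $[u_{[i,i+N-1]}]$. For a word set $Z$, an integer $N\ge1$ and $0\le k<N$, the relation $\sim^Z_k$ on letters is defined by: $b\sim^Z_k c$ iff there exist $n\ge0$, letters $x^{(0)},\dots,x^{(n)}$ and $y^{(1)},\dots,y^{(n)}\in\{ -1,1\}$ with $x^{(0)}=b$, $x^{(n)}=c$, $\sum_{j=1}^n y^{(j)}=0$, and for all $0<i\le n$: $-k\le\sum_{j=1}^{i}y^{(j)}<N-k$, and $x^{(i-1)}x^{(i)}\in\mathcal{L}_2(Z)$ if $y^{(i)}=-1$, $x^{(i)}x^{(i-1)}\in\mathcal{L}_2(Z)$ if $y^{(i)}=1$. For a letter $a$, $G_X(a,N)$ is the undirected graph whose vertices are the pairs $(i,u)$ with $0\le i<N$, $u\in\mathcal{L}_N(X)$, $u_i=a$, and whose edges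 are the pairs $\{(i,w_{[0,N-1]}),(i-1,w_{[1,N]})\}$ with $0<i<N$, $w\in\mathcal{L}_{N+1}(X)$, $w_i=a$. -}

module Defs where

open import Data.Nat using (ℕ; zero; suc; _+_; _∸_; _<_; _≤_)
open import Data.Integer as ℤ using (ℤ; +_; -_; 0ℤ; 1ℤ; -1ℤ)
open import Data.Fin using (Fin; toℕ)
open import Data.Vec as V using (Vec; []; _∷_; lookup; tabulate; init; tail)
open import Data.List as L using (List; []; _∷_; length; take; drop)
open import Data.Maybe using (Maybe; just; nothing; maybe)
import Data.Maybe as M
open import Data.Sign using (Sign)
open import Data.Product using (Σ; ∃; _×_; _,_)
open import Data.Sum using (_⊎_)
open import Relation.Binary.PropositionalEquality using (_≡_)
open import Relation.Binary.Construct.Closure.ReflexiveTransitive using (Star)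

data Word (A : Set) : Set where
  fin   : List A → Word A
  inf   : (ℕ → A) → Word A
  biinf : (ℤ → A) → Word A

WordSet : Set → Set₁
WordSet A = Word A → Set

LengthAtLeast : {A : Set} → ℕ → WordSet A → Set
LengthAtLeast {A} N Z = (l : List A) → Z (fin l) → N ≤ length l

Factor : {A : Set} (n : ℕ) → Vec A n → Word A → Set
Factor n u (fin l)   = ∃ λ (i : ℕ) → take n (drop i l) ≡ V.toList u
Factor n u (inf f)   = ∃ λ (i : ℕ) → u ≡ tabulate (λ j → f (i + toℕ j))
Factor n u (biinf f) = ∃ λ (i : ℤ) → u ≡ tabulate (λ j → f (i ℤ.+ + toℕ j))

Lang : {A : Set} (n : ℕ) → WordSet A → Vec A n → Set
Lang n Z u = ∃ λ w → Z w × Factor n u w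

prefixVec : {A : Set} (N : ℕ) → List A → Maybe (Vec A N)
prefixVec zero    _        = just []
prefixVec (suc N) []       = nothing
prefixVec (suc N) (x ∷ xs) = M.map (x ∷_) (prefixVec N xs)

blocks : {A : Set} (N : ℕ) → List A → List (Vec A N)
blocks N []       = []
blocks N (x ∷ xs) = maybe (λ v → v ∷ blocks N xs) [] (prefixVec N (x ∷ xs))

blockWord : {A : Set} (N : ℕ) → Word A → Word (Vec A N)
blockWord N (fin l)   = fin (blocks N l)
blockWord N (inf f)   = inf (λ i → tabulate (λ j → f (i + toℕ j)))
blockWord N (biinf f) = biinf (λ i → tabulate (λ j → f (i ℤ.+ + toℕ j)))

BlockPres : {A : Set} (N : ℕ) → WordSet A → WordSet (Vec A N)
BlockPres N X w' = ∃ λ w → X w × w' ≡ blockWord N w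

signℤ : Sign → ℤ
signℤ Sign.- = -1ℤ
signℤ Sign.+ = 1ℤ

psum : (ℕ → Sign) → ℕ → ℤ
psum y zero    = 0ℤ
psum y (suc i) = psum y i ℤ.+ signℤ (y (suc i))

Step : {B : Set} → WordSet B → Sign → B → B → Set
Step Z Sign.- p q = Lang 2 Z (p ∷ q ∷ [])
Step Z Sign.+ p q = Lang 2 Z (q ∷ p ∷ [])

RelK : {B : Set} → WordSet B → (N k : ℕ) → B → B → Set
RelK {B} Z N k b c =
  Σ ℕ λ n → Σ (ℕ → B) λ x → Σ (ℕ → Sign) λ y →
    x 0 ≡ b × x n ≡ c × psum y n ≡ 0ℤ ×
    ((i : ℕ) → suc i ≤ n →
       (- (+ k) ℤ.≤ psum y (suc i)) × (psum y (suc i) ℤ.< + N ℤ.- + k) ×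
       Step Z (y (suc i)) (x i) (x (suc i)))

Vertex : {A : Set} → WordSet A → A → (N : ℕ) → ℕ × Vec A N → Set
Vertex X a N (i , u) = i < N × Lang N X u × (∃ λ (j : Fin N) → toℕ j ≡ i × lookup u j ≡ a)

EdgeDir : {A : Set} → WordSet A → A → (N : ℕ) → ℕ × Vec A N → ℕ × Vec A N → Set
EdgeDir X a N p q =
  Σ (Vec _ (suc N)) λ w → Σ ℕ λ i →
    0 < i × i < N × Lang (suc N) X w ×
    (∃ λ (j : Fin (suc N)) → toℕ j ≡ i × lookup w j ≡ a) ×
    p ≡ (i , init w) × q ≡ (i ∸ 1 , tail w)

Edge : {A : Set} → WordSet A → A → (N : ℕ) → ℕ × Vec A N → ℕ × Vec A N → Set
Edge X a N p q = EdgeDir X a N p q ⊎ EdgeDir X a N q p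

SameComponent : {A : Set} → WordSet A → A → (N : ℕ) → ℕ × Vec A N → ℕ × Vec A N → Set
SameComponent X a N p q = Vertex X a N p × Vertex X a N q × Star (Edge X a N) p q

module Submission where

-- A letter [u] of X^[N] together with a position k < N tracks the letter u_k of X.
-- Two consecutive letters of X^[N] are exactly init w and tail w for a window
-- w ∈ L_{N+1}(X), so a step with y = -1 (resp. +1) moves the tracked position
-- down (resp. up) by one while the tracked letter stays the same, and the bounds
-- on the partial sums say precisely that the position k + Σ y stays in [0, N).
-- A walk witnessing [u] ∼_k [v] is therefore a path from (k, u) to (k, v) in
-- G_X(a, N), where a = u_k, and conversely.

open import Defs
open import Data.Nat using (ℕ; zero; suc; _<_; _≤_; z≤n; s≤s)
import Data.Nat as ℕ
import Data.Nat.Properties as ℕP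
open import Data.Integer as ℤ using (ℤ; +_; -_; 0ℤ; 1ℤ; -1ℤ)
import Data.Integer.Properties as ℤP
open import Data.Integer.Tactic.RingSolver using (solve-∀)
open import Data.Fin using (Fin; toℕ; fromℕ<; inject₁)
import Data.Fin.Properties as FinP
open import Data.Vec using (Vec; []; _∷_; lookup; tabulate; init; tail; toList)
import Data.Vec.Properties as VecP
open import Data.List using (List; []; _∷_; take; drop)
import Data.List.Properties as ListP
open import Data.Maybe using (just; nothing)
import Data.Maybe as Maybe
import Data.Maybe.Properties as MaybeP
open import Data.Sign using (Sign)
open import Data.Product using (Σ; ∃; _×_; _,_; proj₁; proj₂)
open import Data.Sum using (inj₁; inj₂)
open import Function.Bundles using (_⇔_; mk⇔)
open import Relation.Binary.PropositionalEquality
open import Relation.Binary.Construct.Closure.ReflexiveTransitive using (Star; ε; _◅_; _◅◅_; map)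

-t+[t+s]≡s : ∀ (t s : ℤ) → - t ℤ.+ (t ℤ.+ s) ≡ s
-t+[t+s]≡s = solve-∀

t+[n-t]≡n : ∀ (t n : ℤ) → t ℤ.+ (n ℤ.- t) ≡ n
t+[n-t]≡n = solve-∀

-t≤s⇒0≤t+s : ∀ (t s : ℤ) → - t ℤ.≤ s → 0ℤ ℤ.≤ t ℤ.+ s
-t≤s⇒0≤t+s t s h = subst (ℤ._≤ t ℤ.+ s) (ℤP.+-inverseʳ t) (ℤP.+-monoʳ-≤ t h)

0≤t+s⇒-t≤s : ∀ (t s : ℤ) → 0ℤ ℤ.≤ t ℤ.+ s → - t ℤ.≤ s
0≤t+s⇒-t≤s t s h = subst₂ ℤ._≤_ (ℤP.+-identityʳ (- t)) (-t+[t+s]≡s t s) (ℤP.+-monoʳ-≤ (- t) h)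

s<n-t⇒t+s<n : ∀ (t s n : ℤ) → s ℤ.< n ℤ.- t → t ℤ.+ s ℤ.< n
s<n-t⇒t+s<n t s n h = subst (t ℤ.+ s ℤ.<_) (t+[n-t]≡n t n) (ℤP.+-monoʳ-< t h)

t+s<n⇒s<n-t : ∀ (t s n : ℤ) → t ℤ.+ s ℤ.< n → s ℤ.< n ℤ.- t
t+s<n⇒s<n-t t s n h = subst₂ ℤ._<_ (-t+[t+s]≡s t s) (ℤP.+-comm (- t) n) (ℤP.+-monoʳ-< (- t) h)

t+s≡t⇒s≡0 : ∀ (t s : ℤ) → t ℤ.+ s ≡ t → s ≡ 0ℤ
t+s≡t⇒s≡0 t s h = trans (sym (-t+[t+s]≡s t s)) (trans (cong (λ z → - t ℤ.+ z) h) (ℤP.+-inverseˡ t))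

+p-1≡+q⇒p≡1+q : ∀ {p q} → + p ℤ.+ -1ℤ ≡ + q → p ≡ suc q
+p-1≡+q⇒p≡1+q {zero} ()
+p-1≡+q⇒p≡1+q {suc p} refl = refl

+p+1≡+q⇒q≡1+p : ∀ {p q} → + p ℤ.+ 1ℤ ≡ + q → q ≡ suc p
+p+1≡+q⇒q≡1+p {p} e = ℤP.+-injective (trans (sym e) (cong +_ (ℕP.+-comm p 1)))

module _ {B : Set} (Z : WordSet B) (N : ℕ) where

  PositionedStep : ℕ × B → ℕ × B → Set
  PositionedStep s t =
    Σ Sign λ σ → Step Z σ (proj₂ s) (proj₂ t) × + proj₁ s ℤ.+ signℤ σ ≡ + proj₁ t × proj₁ t < N

  -- RelK with the tracked position p + Σ y made explicit, from position p to position q.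
  SignedWalk : ℕ → B → ℕ → B → Set
  SignedWalk p b q c =
    Σ ℕ λ n → Σ (ℕ → B) λ x → Σ (ℕ → Sign) λ y →
      x 0 ≡ b × x n ≡ c × + p ℤ.+ psum y n ≡ + q ×
      ((i : ℕ) → suc i ≤ n →
         (0ℤ ℤ.≤ + p ℤ.+ psum y (suc i)) × (+ p ℤ.+ psum y (suc i) ℤ.< + N) ×
         Step Z (y (suc i)) (x i) (x (suc i)))

  RelK⇒SignedWalk : ∀ {k b c} → RelK Z N k b c → SignedWalk k b k c
  RelK⇒SignedWalk {k} (n , x , y , x0 , xn , sum≡0 , walk) =
    n , x , y , x0 , xn , trans (cong (λ s → + k ℤ.+ s) sum≡0) (ℤP.+-identityʳ (+ k)) ,
    λ i i<n → let (lo , hi , st) = walk i i<n in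
      -t≤s⇒0≤t+s (+ k) _ lo , s<n-t⇒t+s<n (+ k) _ (+ N) hi , st

  SignedWalk⇒RelK : ∀ {k b c} → SignedWalk k b k c → RelK Z N k b c
  SignedWalk⇒RelK {k} (n , x , y , x0 , xn , end , walk) =
    n , x , y , x0 , xn , t+s≡t⇒s≡0 (+ k) _ end ,
    λ i i<n → let (lo , hi , st) = walk i i<n in
      0≤t+s⇒-t≤s (+ k) _ lo , t+s<n⇒s<n-t (+ k) _ (+ N) hi , st

  SignedWalk⇒Star : ∀ {p b q c} → SignedWalk p b q c → Star PositionedStep (p , b) (q , c)
  SignedWalk⇒Star {p} {b} (n , x , y , x0 , xn , end , walk) =
    let (r , r≡ , path) = reach n ℕP.≤-refl in
    subst₂ (λ r z → Star PositionedStep (p , b) (r , z)) (ℤP.+-injective (trans r≡ end)) xn path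
    where
      reach : ∀ i → i ≤ n → Σ ℕ λ r → + r ≡ + p ℤ.+ psum y i × Star PositionedStep (p , b) (r , x i)
      reach zero _ =
        p , sym (ℤP.+-identityʳ (+ p)) , subst (λ z → Star PositionedStep (p , b) (p , z)) (sym x0) ε
      reach (suc i) i<n with reach i (ℕP.<⇒≤ i<n) | walk i i<n
      ... | r , r≡ , path | lo , hi , st =
        ℤ.∣ pos ∣ , +∣pos∣≡pos , path ◅◅ (step ◅ ε)
        where
          pos : ℤ
          pos = + p ℤ.+ psum y (suc i)
          +∣pos∣≡pos : + ℤ.∣ pos ∣ ≡ pos
          +∣pos∣≡pos = ℤP.0≤i⇒+∣i∣≡i lo
          moved : + r ℤ.+ signℤ (y (suc i)) ≡ + ℤ.∣ pos ∣
          moved = begin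
            + r ℤ.+ signℤ (y (suc i))                ≡⟨ cong (ℤ._+ signℤ (y (suc i))) r≡ ⟩
            + p ℤ.+ psum y i ℤ.+ signℤ (y (suc i))   ≡⟨ ℤP.+-assoc (+ p) (psum y i) _ ⟩
            pos                                      ≡⟨ sym +∣pos∣≡pos ⟩
            + ℤ.∣ pos ∣                              ∎
            where open ≡-Reasoning
          step : PositionedStep (r , x i) (ℤ.∣ pos ∣ , x (suc i))
          step = y (suc i) , st , moved , ℤP.drop‿+<+ (subst (ℤ._< + N) (sym +∣pos∣≡pos) hi)

  -- Index 0 of a sign sequence is never read by psum.
  consSign : Sign → (ℕ → Sign) → ℕ → Sign
  consSign σ y zero = σ
  consSign σ y (suc zero) = σ
  consSign σ y (suc (suc i)) = y (suc i)

  psum-consSign : ∀ σ y i → psum (consSign σ y) (suc i) ≡ signℤ σ ℤ.+ psum y i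
  psum-consSign σ y zero = ℤP.+-comm 0ℤ (signℤ σ)
  psum-consSign σ y (suc i) =
    trans (cong (ℤ._+ signℤ (y (suc i))) (psum-consSign σ y i)) (ℤP.+-assoc (signℤ σ) _ _)

  consPoint : B → (ℕ → B) → ℕ → B
  consPoint b x zero = b
  consPoint b x (suc i) = x i

  Star⇒SignedWalk : ∀ {p b q c} → Star PositionedStep (p , b) (q , c) → SignedWalk p b q c
  Star⇒SignedWalk {p} {b} ε =
    0 , (λ _ → b) , (λ _ → Sign.+) , refl , refl , ℤP.+-identityʳ (+ p) , λ _ ()
  Star⇒SignedWalk {p} {b} (_◅_ {j = p′ , b′} (σ , st , moved , p′<N) rest)
    with Star⇒SignedWalk rest
  ... | n , x , y , x0 , xn , end , walk =
    suc n , consPoint b x , consSign σ y , refl , xn , trans (shifted n) end , walk′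
    where
      shifted : ∀ i → + p ℤ.+ psum (consSign σ y) (suc i) ≡ + p′ ℤ.+ psum y i
      shifted i = begin
        + p ℤ.+ psum (consSign σ y) (suc i)   ≡⟨ cong (λ s → + p ℤ.+ s) (psum-consSign σ y i) ⟩
        + p ℤ.+ (signℤ σ ℤ.+ psum y i)        ≡⟨ sym (ℤP.+-assoc (+ p) (signℤ σ) (psum y i)) ⟩
        + p ℤ.+ signℤ σ ℤ.+ psum y i          ≡⟨ cong (ℤ._+ psum y i) moved ⟩
        + p′ ℤ.+ psum y i                     ∎
        where open ≡-Reasoning
      walk′ : ∀ i → suc i ≤ suc n →
        (0ℤ ℤ.≤ + p ℤ.+ psum (consSign σ y) (suc i)) × (+ p ℤ.+ psum (consSign σ y) (suc i) ℤ.< + N) ×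
        Step Z (consSign σ y (suc i)) (consPoint b x i) (consPoint b x (suc i))
      walk′ zero _ =
        subst (0ℤ ℤ.≤_) (sym at-p′) (ℤ.+≤+ z≤n) , subst (ℤ._< + N) (sym at-p′) (ℤ.+<+ p′<N) ,
        subst (Step Z σ b) (sym x0) st
        where
          at-p′ : + p ℤ.+ psum (consSign σ y) 1 ≡ + p′
          at-p′ = trans (shifted 0) (ℤP.+-identityʳ (+ p′))
      walk′ (suc i) i<n with walk i (ℕP.≤-pred i<n)
      ... | lo , hi , st′ =
        subst (0ℤ ℤ.≤_) (sym (shifted (suc i))) lo , subst (ℤ._< + N) (sym (shifted (suc i))) hi , st′

mapInvariant : ∀ {I : Set} {R S : I → I → Set} (P : I → Set) →
  (∀ {i j} → R i j → P i → S i j × P j) → ∀ {i j} → Star R i j → P i → Star S i j × P j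
mapInvariant P f ε Pi = ε , Pi
mapInvariant P f (r ◅ rs) Pi =
  let (s , Pj) = f r Pi ; (ss , Pk) = mapInvariant P f rs Pj in s ◅ ss , Pk

module _ {A : Set} where

  LetterAt : ∀ {n} → Vec A n → ℕ → A → Set
  LetterAt {n} v i a = ∃ λ (j : Fin n) → toℕ j ≡ i × lookup v j ≡ a

  LetterAt-< : ∀ {n} {v : Vec A n} {i a} → LetterAt v i a → i < n
  LetterAt-< (j , refl , _) = FinP.toℕ<n j

  lookup-init : ∀ {n} (w : Vec A (suc n)) (j : Fin n) → lookup (init w) j ≡ lookup w (inject₁ j)
  lookup-init (x ∷ y ∷ ws) Fin.zero = refl
  lookup-init (x ∷ y ∷ ws) (Fin.suc j) = lookup-init (y ∷ ws) j

  LetterAt-init⁺ : ∀ {n} (w : Vec A (suc n)) {i a} → i < n → LetterAt w i a → LetterAt (init w) i a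
  LetterAt-init⁺ w i<n (j , refl , w[j]=a) =
    fromℕ< i<n , FinP.toℕ-fromℕ< i<n ,
    trans (lookup-init w (fromℕ< i<n)) (trans (cong (lookup w) (FinP.toℕ-injective same-index)) w[j]=a)
    where
      same-index : toℕ (inject₁ (fromℕ< i<n)) ≡ toℕ j
      same-index = trans (FinP.toℕ-inject₁ (fromℕ< i<n)) (FinP.toℕ-fromℕ< i<n)

  LetterAt-init⁻ : ∀ {n} (w : Vec A (suc n)) {i a} → LetterAt (init w) i a → LetterAt w i a
  LetterAt-init⁻ w (j , refl , w[j]=a) = inject₁ j , FinP.toℕ-inject₁ j , trans (sym (lookup-init w j)) w[j]=a

  LetterAt-tail⁺ : ∀ {n} (w : Vec A (suc n)) {i a} → LetterAt w (suc i) a → LetterAt (tail w) i a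
  LetterAt-tail⁺ (x ∷ xs) (Fin.zero , () , _)
  LetterAt-tail⁺ (x ∷ xs) (Fin.suc j , e , w[j]=a) = j , ℕP.suc-injective e , w[j]=a

  LetterAt-tail⁻ : ∀ {n} (w : Vec A (suc n)) {i a} → LetterAt (tail w) i a → LetterAt w (suc i) a
  LetterAt-tail⁻ (x ∷ xs) (j , e , w[j]=a) = Fin.suc j , cong suc e , w[j]=a

  window : ∀ n → (ℕ → A) → Vec A n
  window n h = tabulate (λ j → h (toℕ j))

  init-tabulate : ∀ {n} (h : Fin (suc n) → A) → init (tabulate h) ≡ tabulate (λ j → h (inject₁ j))
  init-tabulate {zero} h = refl
  init-tabulate {suc n} h = cong (h Fin.zero ∷_) (init-tabulate (λ j → h (Fin.suc j)))

  init-window : ∀ {n h h′} → (∀ m → h m ≡ h′ m) → init (window (suc n) h) ≡ window n h′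
  init-window {h = h} h≗h′ =
    trans (init-tabulate (λ j → h (toℕ j)))
          (VecP.tabulate-cong (λ j → trans (cong h (FinP.toℕ-inject₁ j)) (h≗h′ (toℕ j))))

  tail-window : ∀ {n h h′} → (∀ m → h (suc m) ≡ h′ m) → tail (window (suc n) h) ≡ window n h′
  tail-window h∘suc≗h′ = VecP.tabulate-cong (λ j → h∘suc≗h′ (toℕ j))

  prefixVec⇒take : ∀ n {l : List A} {v} → prefixVec n l ≡ just v → take n l ≡ toList v
  prefixVec⇒take zero {l} {[]} refl = refl
  prefixVec⇒take (suc n) {x ∷ xs} eq with prefixVec n xs in e | eq
  ... | just u | refl = cong (x ∷_) (prefixVec⇒take n e)

  take⇒prefixVec : ∀ n {l : List A} {v} → take n l ≡ toList v → prefixVec n l ≡ just v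
  take⇒prefixVec zero {v = []} _ = refl
  take⇒prefixVec (suc n) {x ∷ xs} {y ∷ v} eq with ListP.∷-injective eq
  ... | refl , e rewrite take⇒prefixVec n e = refl

  prefixVec-init : ∀ n {l : List A} {w} → prefixVec (suc n) l ≡ just w → prefixVec n l ≡ just (init w)
  prefixVec-init zero {w = x ∷ []} _ = refl
  prefixVec-init (suc n) {x ∷ xs} {y ∷ w} eq with prefixVec (suc n) xs in e | eq
  ... | just u | refl = cong (Maybe.map (x ∷_)) (prefixVec-init n e)

  prefixVec-tail : ∀ n {x : A} {l w} → prefixVec (suc n) (x ∷ l) ≡ just w → prefixVec n l ≡ just (tail w)
  prefixVec-tail n {l = l} eq with prefixVec n l | eq
  ... | just u | refl = refl

  prefixVec-∷-nothing : ∀ n {x : A} {l} → prefixVec n (x ∷ l) ≡ nothing → prefixVec n l ≡ nothing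
  prefixVec-∷-nothing (suc n) {l = []} _ = refl
  prefixVec-∷-nothing (suc n) {l = y ∷ ys} eq with prefixVec n (y ∷ ys) in e | eq
  ... | nothing | _ = cong (Maybe.map (y ∷_)) (prefixVec-∷-nothing n e)

  prefixVec-drop-nothing : ∀ n i {l : List A} → prefixVec n l ≡ nothing → prefixVec n (drop i l) ≡ nothing
  prefixVec-drop-nothing n zero eq = eq
  prefixVec-drop-nothing n (suc i) {[]} eq = eq
  prefixVec-drop-nothing n (suc i) {x ∷ xs} eq = prefixVec-drop-nothing n i (prefixVec-∷-nothing n eq)

  blocks-nothing : ∀ n {l : List A} → prefixVec n l ≡ nothing → blocks n l ≡ []
  blocks-nothing n {[]} _ = refl
  blocks-nothing n {x ∷ xs} eq rewrite eq = refl

  drop-blocks : ∀ n i (l : List A) → drop i (blocks n l) ≡ blocks n (drop i l)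
  drop-blocks n zero l = refl
  drop-blocks n (suc i) [] = refl
  drop-blocks n (suc i) (x ∷ xs) with prefixVec n (x ∷ xs) in eq
  ... | just _ = drop-blocks n i xs
  ... | nothing = sym (blocks-nothing n (prefixVec-drop-nothing n i (prefixVec-∷-nothing n eq)))

  blocks-pair⁻ : ∀ n {l : List A} {p q} → take 2 (blocks n l) ≡ p ∷ q ∷ [] →
    Σ (Vec A (suc n)) λ w → prefixVec (suc n) l ≡ just w × init w ≡ p × tail w ≡ q
  blocks-pair⁻ n {x ∷ xs} eq with prefixVec n (x ∷ xs) in e₁
  blocks-pair⁻ n {x ∷ y ∷ ys} eq | just p with prefixVec n (y ∷ ys) in e₂
  blocks-pair⁻ n {x ∷ y ∷ ys} refl | just p | just q =
    x ∷ q , refl ,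
    MaybeP.just-injective (trans (sym (prefixVec-init n (cong (Maybe.map (x ∷_)) e₂))) e₁) , refl

  blocks-pair⁺ : ∀ n {l : List A} {w} → 1 ≤ n → prefixVec (suc n) l ≡ just w →
    take 2 (blocks n l) ≡ init w ∷ tail w ∷ []
  blocks-pair⁺ n {x ∷ xs} 1≤n eq
    with prefixVec-init n eq | prefixVec-tail n eq
  blocks-pair⁺ (suc n) {x ∷ y ∷ ys} 1≤n eq | e₁ | e₂ rewrite e₁ | e₂ = refl

  init-tail-windowℕ : ∀ n (f : ℕ → A) i →
    init (window (suc n) (λ m → f (i ℕ.+ m))) ≡ window n (λ m → f (i ℕ.+ 0 ℕ.+ m)) ×
    tail (window (suc n) (λ m → f (i ℕ.+ m))) ≡ window n (λ m → f (i ℕ.+ 1 ℕ.+ m))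
  init-tail-windowℕ n f i =
    init-window (λ m → cong f (cong (ℕ._+ m) (sym (ℕP.+-identityʳ i)))) ,
    tail-window {h = λ m → f (i ℕ.+ m)} (λ m → cong f (sym (ℕP.+-assoc i 1 m)))

  init-tail-windowℤ : ∀ n (f : ℤ → A) i →
    init (window (suc n) (λ m → f (i ℤ.+ + m))) ≡ window n (λ m → f (i ℤ.+ + 0 ℤ.+ + m)) ×
    tail (window (suc n) (λ m → f (i ℤ.+ + m))) ≡ window n (λ m → f (i ℤ.+ + 1 ℤ.+ + m))
  init-tail-windowℤ n f i =
    init-window (λ m → cong f (cong (ℤ._+ + m) (sym (ℤP.+-identityʳ i)))) ,
    tail-window {h = λ m → f (i ℤ.+ + m)} (λ m → cong f (sym (ℤP.+-assoc i (+ 1) (+ m))))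

module _ {A : Set} (X : WordSet A) (N : ℕ) where

  Lang₂-BlockPres⁻ : ∀ {p q} → Lang 2 (BlockPres N X) (p ∷ q ∷ []) →
    Σ (Vec A (suc N)) λ w → Lang (suc N) X w × init w ≡ p × tail w ≡ q
  Lang₂-BlockPres⁻ (_ , (fin l , Xl , refl) , i , eq)
    with blocks-pair⁻ N {drop i l} (trans (cong (take 2) (sym (drop-blocks N i l))) eq)
  ... | w , e , w⁻ , w⁺ = w , (fin l , Xl , i , prefixVec⇒take (suc N) e) , w⁻ , w⁺
  Lang₂-BlockPres⁻ (_ , (inf f , Xf , refl) , i , refl) =
    let (init≡ , tail≡) = init-tail-windowℕ N f i in
    window (suc N) (λ m → f (i ℕ.+ m)) , (inf f , Xf , i , refl) , init≡ , tail≡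
  Lang₂-BlockPres⁻ (_ , (biinf f , Xf , refl) , i , refl) =
    let (init≡ , tail≡) = init-tail-windowℤ N f i in
    window (suc N) (λ m → f (i ℤ.+ + m)) , (biinf f , Xf , i , refl) , init≡ , tail≡

  Lang₂-BlockPres⁺ : 1 ≤ N → ∀ {w} → Lang (suc N) X w → Lang 2 (BlockPres N X) (init w ∷ tail w ∷ [])
  Lang₂-BlockPres⁺ 1≤N (fin l , Xl , i , e) =
    blockWord N (fin l) , (fin l , Xl , refl) , i ,
    trans (cong (take 2) (drop-blocks N i l)) (blocks-pair⁺ N {drop i l} 1≤N (take⇒prefixVec (suc N) e))
  Lang₂-BlockPres⁺ 1≤N (inf f , Xf , i , refl) =
    let (init≡ , tail≡) = init-tail-windowℕ N f i in
    blockWord N (inf f) , (inf f , Xf , refl) , i , cong₂ _∷_ init≡ (cong (_∷ []) tail≡)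
  Lang₂-BlockPres⁺ 1≤N (biinf f , Xf , i , refl) =
    let (init≡ , tail≡) = init-tail-windowℤ N f i in
    blockWord N (biinf f) , (biinf f , Xf , refl) , i , cong₂ _∷_ init≡ (cong (_∷ []) tail≡)

  PositionedStep⇒Edge : ∀ {a p b q c} → PositionedStep (BlockPres N X) N (p , b) (q , c) →
    LetterAt b p a → Edge X a N (p , b) (q , c) × LetterAt c q a
  PositionedStep⇒Edge {p = p} {q = q} (Sign.- , st , moved , _) b[p]=a
    with +p-1≡+q⇒p≡1+q {p} {q} moved | Lang₂-BlockPres⁻ st
  ... | refl | w , Lw , refl , refl =
    inj₁ (w , _ , s≤s z≤n , LetterAt-< {v = init w} b[p]=a , Lw , LetterAt-init⁻ w b[p]=a , refl , refl) ,
    LetterAt-tail⁺ w (LetterAt-init⁻ w b[p]=a)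
  PositionedStep⇒Edge {p = p} {q = q} (Sign.+ , st , moved , q<N) b[p]=a
    with +p+1≡+q⇒q≡1+p {p} {q} moved | Lang₂-BlockPres⁻ st
  ... | refl | w , Lw , refl , refl =
    inj₂ (w , _ , s≤s z≤n , q<N , Lw , LetterAt-tail⁻ w b[p]=a , refl , refl) ,
    LetterAt-init⁺ w q<N (LetterAt-tail⁻ w b[p]=a)

  Edge⇒PositionedStep : 1 ≤ N → ∀ {a p b q c} → Edge X a N (p , b) (q , c) →
    PositionedStep (BlockPres N X) N (p , b) (q , c)
  Edge⇒PositionedStep 1≤N (inj₁ (w , suc i , _ , 1+i<N , Lw , _ , refl , refl)) =
    Sign.- , Lang₂-BlockPres⁺ 1≤N Lw , refl , ℕP.<⇒≤ 1+i<N
  Edge⇒PositionedStep 1≤N (inj₂ (w , suc i , _ , 1+i<N , Lw , _ , refl , refl)) =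
    Sign.+ , Lang₂-BlockPres⁺ 1≤N Lw , cong +_ (ℕP.+-comm i 1) , 1+i<N

proposition3 : (m : ℕ) (X : WordSet (Fin m)) (N : ℕ) → 1 ≤ N → LengthAtLeast N X →
    (u v : Vec (Fin m) N) → Lang N X u → Lang N X v → (k : ℕ) → k < N →
    RelK (BlockPres N X) N k u v ⇔ (∃ λ (a : Fin m) → SameComponent X a N (k , u) (k , v))
proposition3 m X N 1≤N _ u v Lu Lv k k<N = mk⇔ to from
  where
    a : Fin m
    a = lookup u (fromℕ< k<N)

    u[k]=a : LetterAt u k a
    u[k]=a = fromℕ< k<N , FinP.toℕ-fromℕ< k<N , refl

    to : RelK (BlockPres N X) N k u v → ∃ λ a → SameComponent X a N (k , u) (k , v)
    to rel with mapInvariant (λ (p , b) → LetterAt b p a) (PositionedStep⇒Edge X N)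
                  (SignedWalk⇒Star _ N (RelK⇒SignedWalk _ N rel)) u[k]=a
    ... | path , v[k]=a = a , (k<N , Lu , u[k]=a) , (k<N , Lv , v[k]=a) , path

    from : (∃ λ a → SameComponent X a N (k , u) (k , v)) → RelK (BlockPres N X) N k u v
    from (_ , _ , _ , path) =
      SignedWalk⇒RelK _ N (Star⇒SignedWalk _ N (map (Edge⇒PositionedStep X N 1≤N) path))
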